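{- Let $f:A\to B$ be a homomorphism of abelian groups. (1) Suppose $B_{\mathrm{div}}=0$. Then there is an exact sequence $0\to A_{\mathrm{div}}\to\ker(f)\to\varprojlim_n\ker(f/n)$. (2) Suppose there is $N\in\mathbb{Z}_{>0}$ such that the canonical map $\ker(f/nN)\to\ker(f\otimes\mathbb{Q}/\mathbb{Z})$ is bijective for all $n\in\mathbb{Z}_{>0}$. Then $\varprojlim_n\ker(f/n)=0$ (hence $\ker(f)=A_{\mathrm{div}}$ if $B_{\mathrm{div}}=0$).
   Context: $A_{\mathrm{div}}:=\bigcap_{n\in\mathbb{Z}_{>0}}nA$ is the subgroup of divisible elements. For $n\in\mathbb{Z}_{>0}$, $f/n:=f\otimes\mathbb{Z}/n:A/nA\to B/nB$. The inverse system $\{\ker(f/n)\}_n$ uses the maps $\ker(f/nm)\to\ker(f/n)$ induced by the identity of $A$; the map $\ker(f)\to\varprojlim\ker(f/n)$ is the natural one. The canonical map $\ker(f/n)\to\ker(f\otimes\mathbb{Q}/\mathbb{Z})$ is induced by $\mathbb{Z}/n\to\mathbb{Q}/\mathbb{Z}$, $1\mapsto1/n$ (equivalently the maps $\ker(f/n)\to\ker(f/nm)$ induced by multiplication by $m$ on $A$ form a direct system with limit $\ker(f\otimes\mathbb{Q}/\mathbb{Z})$). -}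

module Defs where

open import Level using (Level; _⊔_)
open import Data.Nat using (ℕ; _*_; _<_; _≡ᵇ_)
open import Data.Product using (Σ; ∃; _×_; _,_)
open import Relation.Binary.PropositionalEquality using (_≡_)
open import Algebra.Bundles using (AbelianGroup)
open import Algebra.Morphism.Structures using (module GroupMorphisms)
import Algebra.Definitions.RawMonoid as RM

module _ {a ℓ : Level} (A : AbelianGroup a ℓ) where
  open AbelianGroup A

  infixr 8 _·_
  _·_ : ℕ → Carrier → Carrier
  n · x = RM._×_ rawMonoid n x

  sub : Carrier → Carrier → Carrier
  sub x y = x ∙ (y ⁻¹)

  InMult : ℕ → Carrier → Set (a ⊔ ℓ)
  InMult n x = ∃ λ c → n · c ≈ x

  EqMod : ℕ → Carrier → Carrier → Set (a ⊔ ℓ)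
  EqMod n x y = InMult n (sub x y)

  Divisible : Carrier → Set (a ⊔ ℓ)
  Divisible x = (n : ℕ) → 0 < n → InMult n x

  DivZero : Set (a ⊔ ℓ)
  DivZero = (x : Carrier) → Divisible x → x ≈ ε

IsHom : {a ℓa b ℓb : Level} (A : AbelianGroup a ℓa) (B : AbelianGroup b ℓb) →
        (AbelianGroup.Carrier A → AbelianGroup.Carrier B) → Set (a ⊔ ℓa ⊔ ℓb)
IsHom A B f = GroupMorphisms.IsGroupHomomorphism
                (AbelianGroup.rawGroup A) (AbelianGroup.rawGroup B) f

module _ {a ℓa b ℓb : Level} (A : AbelianGroup a ℓa) (B : AbelianGroup b ℓb)
         (f : AbelianGroup.Carrier A → AbelianGroup.Carrier B) where
  private
    module A = AbelianGroup A
    module B = AbelianGroup B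

  InKer : A.Carrier → Set ℓb
  InKer x = f x B.≈ B.ε

  -- ker(f/n) is represented as { x ∈ A | f x ∈ nB } modulo nA
  -- (elements are representatives x ∈ A, equality is EqMod A n).
  InKerMod : ℕ → A.Carrier → Set (b ⊔ ℓb)
  InKerMod n x = InMult B n (f x)

  -- Elements of lim_n ker(f/n): families (x_n)_{n>0} of representatives with
  -- x_n ∈ ker(f/n), compatible under the maps ker(f/nm) → ker(f/n) induced
  -- by id_A, i.e. x_{nm} ≡ x_n mod nA.
  IsLimElem : (ℕ → A.Carrier) → Set (a ⊔ ℓa ⊔ b ⊔ ℓb)
  IsLimElem x = ((n : ℕ) → 0 < n → InKerMod n (x n))
              × ((n m : ℕ) → 0 < n → 0 < m → EqMod A n (x (n * m)) (x n))

  LimZero : (ℕ → A.Carrier) → Set (a ⊔ ℓa)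
  LimZero x = (n : ℕ) → 0 < n → InMult A n (x n)

  LimVanishes : Set (a ⊔ ℓa ⊔ b ⊔ ℓb)
  LimVanishes = (x : ℕ → A.Carrier) → IsLimElem x → LimZero x

  toLim : A.Carrier → (ℕ → A.Carrier)
  toLim x _ = x

  -- ker(f ⊗ Q/Z) as the direct limit of ker(f/n) along the maps
  -- ker(f/n) → ker(f/nm) induced by multiplication by m on A.
  -- An element is a pair (k , y) with k > 0 and y ∈ ker(f/k).
  ColimElem : Set (a ⊔ b ⊔ ℓb)
  ColimElem = Σ ℕ λ k → Σ A.Carrier λ y → (0 < k) × InKerMod k y

  -- Equality in the direct limit: (k , y) = (k' , y') iff they become equal
  -- at a common later stage L = k m = k' m'.
  ColimEq : ColimElem → ColimElem → Set (a ⊔ ℓa)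
  ColimEq (k , y , _) (k' , y' , _) =
    Σ ℕ λ m → Σ ℕ λ m' → (0 < m) × (0 < m') × (k * m ≡ k' * m')
      × EqMod A (k * m) (_·_ A m y) (_·_ A m' y')

  canon : (n : ℕ) → 0 < n → (x : A.Carrier) → InKerMod n x → ColimElem
  canon n pos x px = n , x , pos , px

  CanonBijective : (n : ℕ) → 0 < n → Set (a ⊔ ℓa ⊔ b ⊔ ℓb)
  CanonBijective n pos =
    ((x y : A.Carrier) (px : InKerMod n x) (py : InKerMod n y) →
       ColimEq (canon n pos x px) (canon n pos y py) → EqMod A n x y)
    × ((z : ColimElem) →
       Σ A.Carrier λ x → Σ (InKerMod n x) λ px → ColimEq (canon n pos x px) z)

-- Part (1) is immediate: f maps A_div into B_div = 0, and a family constant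
-- at x vanishes in lim ker(f/n) exactly when x ∈ nA for all n.
-- For part (2) let (x_n) be a compatible family, fix n and put K = nN. Lift the
-- class of x_{K²} along the surjection ker(f/K) → ker(f ⊗ Q/Z) to some z; then
-- K z and x_{K²} have the same image in the colimit, so by injectivity at level
-- K² they agree modulo K²A. Hence x_{K²} ∈ KA, so x_K ∈ KA ⊆ nA by
-- compatibility, and finally x_n ∈ nA.
module Submission where

open import Defs hiding (_·_)
open import Level using (Level)
open import Data.Nat using (ℕ; _*_; _<_; zero; suc; s≤s; z≤n; >-nonZero)
open import Data.Nat.Properties using (*-comm; *-assoc; *-cancelˡ-≡)
open import Data.Nat.Divisibility using (_∣_; divides; m∣m*n)
open import Data.Product using (_×_; _,_)
open import Function using (id)
open import Function.Bundles using (_⇔_; mk⇔)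
open import Algebra.Bundles using (AbelianGroup)
open import Algebra.Morphism.Structures using (module GroupMorphisms)
open import Relation.Binary.PropositionalEquality as ≡ using (_≡_)
import Algebra.Properties.AbelianGroup as AbelianGroupProperties
import Algebra.Properties.Group as GroupProperties
import Algebra.Properties.CommutativeMonoid.Mult as CommutativeMonoidMult

*-pos : {m n : ℕ} → 0 < m → 0 < n → 0 < m * n
*-pos {suc _} {suc _} _ _ = s≤s z≤n

module Multiples {a ℓ : Level} (A : AbelianGroup a ℓ) where
  open AbelianGroup A public
  open GroupProperties group using (inverseʳ-unique)
  open AbelianGroupProperties A using (⁻¹-anti-homo‿-; xyx⁻¹≈y)
  open import Relation.Binary.Reasoning.Setoid setoid

  -- The library's n-fold sum, definitionally the `_·_ A` of Defs.
  open CommutativeMonoidMult commutativeMonoid public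
    using (×-congˡ; ×-congʳ; ×-assocˡ; ×-distrib-+) renaming (_×_ to _·_)

  ·-zeroʳ : ∀ n → n · ε ≈ ε
  ·-zeroʳ zero    = refl
  ·-zeroʳ (suc n) = trans (identityˡ _) (·-zeroʳ n)

  ·-⁻¹ : ∀ n x → n · (x ⁻¹) ≈ (n · x) ⁻¹
  ·-⁻¹ n x = inverseʳ-unique (n · x) (n · (x ⁻¹)) (begin
    n · x ∙ n · (x ⁻¹) ≈⟨ ×-distrib-+ x (x ⁻¹) n ⟨
    n · (x ∙ x ⁻¹)    ≈⟨ ×-congʳ n (inverseʳ x) ⟩
    n · ε             ≈⟨ ·-zeroʳ n ⟩
    ε                 ∎)

  InMult-resp-≈ : ∀ n {x y} → x ≈ y → InMult A n x → InMult A n y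
  InMult-resp-≈ n x≈y (c , nc≈x) = c , trans nc≈x x≈y

  InMult-ε : ∀ n → InMult A n ε
  InMult-ε n = ε , ·-zeroʳ n

  InMult-∙ : ∀ n {x y} → InMult A n x → InMult A n y → InMult A n (x ∙ y)
  InMult-∙ n (c , nc≈x) (d , nd≈y) =
    c ∙ d , trans (×-distrib-+ c d n) (∙-cong nc≈x nd≈y)

  InMult-⁻¹ : ∀ n {x} → InMult A n x → InMult A n (x ⁻¹)
  InMult-⁻¹ n (c , nc≈x) = c ⁻¹ , trans (·-⁻¹ n c) (⁻¹-cong nc≈x)

  InMult-· : ∀ m n {x} → InMult A n x → InMult A (m * n) (m · x)
  InMult-· m n (c , nc≈x) = c , trans (sym (×-assocˡ c m n)) (×-congʳ m nc≈x)

  InMult-∣ : ∀ k n {x} → k ∣ n → InMult A n x → InMult A k x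
  InMult-∣ k _ (divides q ≡.refl) (c , qkc≈x) =
    q · c , trans (×-assocˡ c k q) (trans (×-congˡ (*-comm k q)) qkc≈x)

  InMult-EqMod : ∀ n {x y} → InMult A n x → EqMod A n x y → InMult A n y
  InMult-EqMod n {x} {y} x∈nA x-y∈nA =
    InMult-resp-≈ n y≈x-[x-y] (InMult-∙ n x∈nA (InMult-⁻¹ n x-y∈nA))
    where
    y≈x-[x-y] : x ∙ (x ∙ y ⁻¹) ⁻¹ ≈ y
    y≈x-[x-y] = begin
      x ∙ (x ∙ y ⁻¹) ⁻¹  ≈⟨ ∙-congˡ (⁻¹-anti-homo‿- x y) ⟩
      x ∙ (y ∙ x ⁻¹)     ≈⟨ assoc x y (x ⁻¹) ⟨
      x ∙ y ∙ x ⁻¹       ≈⟨ xyx⁻¹≈y x y ⟩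
      y                  ∎

  EqMod-refl : ∀ n x → EqMod A n x x
  EqMod-refl n x = InMult-resp-≈ n (sym (inverseʳ x)) (InMult-ε n)

  EqMod-respˡ : ∀ n {x x′ y} → x ≈ x′ → EqMod A n x y → EqMod A n x′ y
  EqMod-respˡ n x≈x′ = InMult-resp-≈ n (∙-congʳ x≈x′)

module Kernels {a ℓa b ℓb : Level} (A : AbelianGroup a ℓa) (B : AbelianGroup b ℓb)
  (f : AbelianGroup.Carrier A → AbelianGroup.Carrier B) (hom : IsHom A B f) where
  module A = Multiples A
  module B = Multiples B
  open A using (_·_)
  open GroupMorphisms.IsGroupHomomorphism hom using (ε-homo; homo; ⟦⟧-cong)

  f-· : ∀ n x → f (n · x) B.≈ n B.· f x
  f-· zero    x = ε-homo
  f-· (suc n) x = B.trans (homo x (n · x)) (B.∙-congˡ (f-· n x))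

  Divisible⇒InKer : DivZero B → ∀ x → Divisible A x → InKer A B f x
  Divisible⇒InKer B-div≈0 x x-div = B-div≈0 (f x) λ n n>0 →
    let (c , nc≈x) = x-div n n>0 in f c , B.trans (B.sym (f-· n c)) (⟦⟧-cong nc≈x)

  InKerMod-· : ∀ m k {z} → InKerMod A B f k z → InKerMod A B f (m * k) (m · z)
  InKerMod-· m k {z} fz∈kB = B.InMult-resp-≈ (m * k) (B.sym (f-· m z)) (B.InMult-· m k fz∈kB)

  InKer⇒IsLimElem : ∀ x → InKer A B f x → IsLimElem A B f (toLim A B f x)
  InKer⇒IsLimElem x fx≈ε =
    (λ n _ → B.InMult-resp-≈ n (B.sym fx≈ε) (B.InMult-ε n)) ,
    (λ n _ _ _ → A.EqMod-refl n x)

  InKer⇒Divisible : LimVanishes A B f → ∀ x → InKer A B f x → Divisible A x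
  InKer⇒Divisible lim≈0 x x∈ker = lim≈0 (toLim A B f x) (InKer⇒IsLimElem x x∈ker)

  -- If z ∈ ker(f/K) lifts the class of y, injectivity at level L forces y ≡ M z mod LA.
  CanonBijective⇒InKerMod⇒InMult :
    ∀ {K M L} (K>0 : 0 < K) (L>0 : 0 < L) → L ≡ M * K →
    CanonBijective A B f K K>0 → CanonBijective A B f L L>0 →
    ∀ y → InKerMod A B f L y → InMult A M y
  CanonBijective⇒InKerMod⇒InMult {K} {M} {L} K>0 L>0 L≡MK (_ , surj) (inj , _) y y∈ker
    with surj (L , y , L>0 , y∈ker)
  ... | z , z∈ker , m , m′ , _ , m′>0 , Km≡Lm′ , mz≡m′y =
    A.InMult-EqMod M (z , A.refl) (A.InMult-∣ M L M∣L Mz≡y)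
    where
    open ≡.≡-Reasoning
    m≡m′M : m ≡ m′ * M
    m≡m′M = *-cancelˡ-≡ m (m′ * M) K {{>-nonZero K>0}} (begin
      K * m        ≡⟨ Km≡Lm′ ⟩
      L * m′       ≡⟨ ≡.cong (_* m′) L≡MK ⟩
      M * K * m′   ≡⟨ ≡.cong (_* m′) (*-comm M K) ⟩
      K * M * m′   ≡⟨ *-assoc K M m′ ⟩
      K * (M * m′) ≡⟨ ≡.cong (K *_) (*-comm M m′) ⟩
      K * (m′ * M) ∎)

    Mz∈ker : InKerMod A B f L (M · z)
    Mz∈ker = ≡.subst (λ l → InKerMod A B f l (M · z)) (≡.sym L≡MK) (InKerMod-· M K z∈ker)

    mz≈m′Mz : m · z A.≈ m′ · (M · z)
    mz≈m′Mz = A.trans (A.×-congˡ m≡m′M) (A.sym (A.×-assocˡ z m′ M))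

    same-class : ColimEq A B f (canon A B f L L>0 (M · z) Mz∈ker) (canon A B f L L>0 y y∈ker)
    same-class = m′ , m′ , m′>0 , m′>0 , ≡.refl ,
      A.EqMod-respˡ (L * m′) mz≈m′Mz (≡.subst (λ l → EqMod A l (m · z) (m′ · y)) Km≡Lm′ mz≡m′y)

    Mz≡y : EqMod A L (M · z) y
    Mz≡y = inj (M · z) y Mz∈ker y∈ker same-class

    M∣L : M ∣ L
    M∣L = ≡.subst (M ∣_) (≡.sym L≡MK) (m∣m*n K)

  CanonBijective⇒LimVanishes : ∀ N → 0 < N →
    (∀ n (n>0 : 0 < n) (nN>0 : 0 < n * N) → CanonBijective A B f (n * N) nN>0) →
    LimVanishes A B f
  CanonBijective⇒LimVanishes N N>0 bij x (x∈ker , compat) n n>0 =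
    A.InMult-EqMod n xK∈nA (compat n N n>0 N>0)
    where
    K = n * N
    -- K · K, written as a multiple of N so that `bij` applies at this level
    L = n * K * N
    K>0 = *-pos n>0 N>0
    nK>0 = *-pos n>0 K>0
    L>0 = *-pos nK>0 N>0

    L≡KK : L ≡ K * K
    L≡KK = begin
      n * K * N   ≡⟨ *-assoc n K N ⟩
      n * (K * N) ≡⟨ ≡.cong (n *_) (*-comm K N) ⟩
      n * (N * K) ≡⟨ *-assoc n N K ⟨
      K * K       ∎
      where open ≡.≡-Reasoning

    xL∈KA : InMult A K (x L)
    xL∈KA = CanonBijective⇒InKerMod⇒InMult {M = K} K>0 L>0 L≡KK
      (bij n n>0 K>0) (bij (n * K) nK>0 L>0) (x L) (x∈ker L L>0)

    xK∈KA : InMult A K (x K)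
    xK∈KA = A.InMult-EqMod K xL∈KA
      (≡.subst (λ l → EqMod A K (x l) (x K)) (≡.sym L≡KK) (compat K K K>0 K>0))

    xK∈nA : InMult A n (x K)
    xK∈nA = A.InMult-∣ n K (m∣m*n N) xK∈KA

lemma4p5 : {a ℓa b ℓb : Level} (A : AbelianGroup a ℓa) (B : AbelianGroup b ℓb)
    (f : AbelianGroup.Carrier A → AbelianGroup.Carrier B) → IsHom A B f →
    -- (1) if B_div = 0 : 0 → A_div → ker f → lim ker(f/n) is exact
    (DivZero B →
       ((x : AbelianGroup.Carrier A) → Divisible A x → InKer A B f x)
       × ((x : AbelianGroup.Carrier A) → InKer A B f x →
            (LimZero A B f (toLim A B f x) ⇔ Divisible A x)))
    ×
    -- (2) if some N > 0 makes all ker(f/nN) → ker(f ⊗ Q/Z) bijective,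
    --     then lim ker(f/n) = 0, and hence ker f = A_div when B_div = 0
    ((N : ℕ) → 0 < N →
       ((n : ℕ) → (pos : 0 < n) → (posN : 0 < n * N) → CanonBijective A B f (n * N) posN) →
       LimVanishes A B f
       × (DivZero B → (x : AbelianGroup.Carrier A) → InKer A B f x → Divisible A x))
lemma4p5 A B f hom =
  (λ B-div≈0 → Divisible⇒InKer B-div≈0 , λ x _ → mk⇔ id id) ,
  -- ker f ⊆ A_div needs only lim ker(f/n) = 0, not B_div = 0.
  (λ N N>0 bij → let lim≈0 = CanonBijective⇒LimVanishes N N>0 bij in
     lim≈0 , λ _ → InKer⇒Divisible lim≈0)
  where open Kernels A B f hom
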